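{- Let $q$ be a prime power, $d\geq 1$, $t\in\mathbb{F}_q$ nonzero, $k\geq 1$ an integer, and $E\subseteq\mathbb{F}_q^d$. Let $$N_k(E)=\left|\{(y,x_1,\dots,x_k)\in E^{k+1}: x_1,\dots,x_k \text{ distinct},\ y\cdot x_i=t \ \text{for all } i\}\right|$$ be the number of non-degenerate $k$-stars in the dot-product graph on $E$. There is a constant $C_k$ depending only on $k$ such that if $|E|\geq C_k\,q^{\frac{d+1}{2}}$, then $$N_k(E)\geq \frac{|E|^{k+1}}{2q^k}.$$
   Context: For $x,y\in\mathbb{F}_q^d$, $x\cdot y=\sum_{i=1}^d x_iy_i$. A $(k+1)$-tuple $(y,x_1,\dots,x_k)$ of points is a $k$-star if $y\cdot x_i=t$ for each $i$; it is non-degenerate if the $x_i$ are distinct. -}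

module Defs where

open import Level using (0ℓ)
open import Algebra.Bundles using (CommutativeRing)
open import Data.Nat using (ℕ; zero; suc)
open import Data.List using (List; []; _∷_; [_]; length; filter; map; concatMap; cartesianProduct; foldr)
open import Data.List.Membership.Propositional using (_∈_)
open import Data.List.Relation.Unary.Unique.Propositional using (Unique)
open import Data.Vec using (Vec; toList; zipWith)
  renaming ([] to []ᵥ; _∷_ to _∷ᵥ_)
import Data.Vec.Properties as VP
import Data.Vec.Relation.Unary.All as VAll
import Data.List.Relation.Unary.Unique.DecPropositional as UDec
open import Data.Product using (Σ; ∃; _×_; _,_; proj₁; proj₂)
open import Relation.Nullary using (¬_; Dec)
open import Relation.Nullary.Decidable using (_×-dec_)
open import Relation.Binary.Definitions using (DecidableEquality)
open import Relation.Binary.PropositionalEquality using (_≡_)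

record FiniteField : Set₁ where
  field
    cring : CommutativeRing 0ℓ 0ℓ
  open CommutativeRing cring public
  field
    ≈⇒≡      : ∀ {x y} → x ≈ y → x ≡ y
    0≢1      : ¬ (0# ≡ 1#)
    inverse  : ∀ x → ¬ (x ≡ 0#) → ∃ λ y → x * y ≡ 1#
    _≟F_     : DecidableEquality Carrier
    elements : List Carrier
    complete : ∀ x → x ∈ elements
    distinct : Unique elements

  order : ℕ
  order = length elements

module _ (F : FiniteField) where
  open FiniteField F

  dot : ∀ {d} → Vec Carrier d → Vec Carrier d → Carrier
  dot x y = foldr _+_ 0# (toList (zipWith _*_ x y))

  tuples : ∀ {A : Set} → List A → (k : ℕ) → List (Vec A k)
  tuples L zero    = [ []ᵥ ]
  tuples L (suc k) = concatMap (λ a → map (a ∷ᵥ_) (tuples L k)) L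

  IsStar : ∀ {d k} → Carrier → Vec Carrier d × Vec (Vec Carrier d) k → Set
  IsStar t (y , xs) = Unique (toList xs) × VAll.All (λ x → dot y x ≡ t) xs

  isStar? : ∀ {d k} (t : Carrier) (p : Vec Carrier d × Vec (Vec Carrier d) k) → Dec (IsStar t p)
  isStar? t (y , xs) =
    UDec.unique? (VP.≡-dec _≟F_) (toList xs) ×-dec VAll.all? (λ x → dot y x ≟F t) xs

  -- N_k(E): number of (y,x₁,…,xₖ) ∈ E^{k+1} with xᵢ distinct and y·xᵢ = t,
  -- where E ⊆ F^d is given as a duplicate-free list.
  Nstars : ∀ {d} (k : ℕ) (t : Carrier) (E : List (Vec Carrier d)) → ℕ
  Nstars k t E = length (filter (isStar? t) (cartesianProduct E (tuples E k)))

-- For y ∈ 𝔽_q^d let δ(y) be the number of x ∈ E with y · x = t, so that the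
-- number of non-degenerate k-stars centred at y ∈ E is δ(y)(δ(y)−1)⋯(δ(y)−k+1).
-- A hyperplane of 𝔽_q^d has q^{d−1} points and, since t ≠ 0, the set where
-- y · v = z · v = t (y ≠ z) has at most q^{d−2}: it is the smallest level set of
-- (y · v, z · v) on the hyperplane (y − z) · v = 0.  These give the first two
-- moments of δ over 𝔽_q^d, hence ∑_{y ∈ E} (|E| − q δ(y))² ≤ 2 |E| q^{d+1}.
-- If |E|² ≥ (20k)² q^{d+1}, all but |E|/3 centres y ∈ E therefore have
-- δ(y) − k ≥ (1 − 1/(4k)) |E|/q, and Bernoulli's inequality
-- (1 − 1/(4k))^k ≥ 3/4 turns this into N_k(E) ≥ |E|^{k+1} / (2 q^k).

module Submission where

open import Defs

open import Algebra.Bundles using (Ring)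
open import Level using (Level)
open import Data.Empty using (⊥-elim)
open import Data.Nat using (ℕ; zero; suc; _+_; _*_; _^_; _∸_; _≤_; _≤?_; z≤n; s≤s; s≤s⁻¹; NonZero; >-nonZero)
open import Data.Nat.Properties
open import Data.Nat.Tactic.RingSolver using (solve-∀)
open import Data.Vec using (Vec; []; _∷_)
import Data.Vec as V
import Data.Vec.Properties as VP
open import Data.List using (List; []; _∷_; length; filter; map; concat; concatMap; cartesianProduct; _++_)
open import Data.List.Membership.Propositional using (_∈_)
import Data.List.Membership.Propositional.Properties as ∈
open import Data.List.Relation.Unary.All using (All; []; _∷_)
import Data.List.Relation.Unary.All as All
import Data.List.Relation.Unary.Any as Any
open import Data.List.Relation.Unary.Any using (here; there)
open import Data.List.Relation.Unary.AllPairs using ([]; _∷_)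
open import Data.List.Relation.Unary.Unique.Propositional using (Unique)
open import Data.Product using (∃; ∃-syntax; _×_; _,_; proj₁; proj₂)
open import Data.Sum using (inj₁; inj₂)
import Data.Vec.Relation.Unary.All as VAll
import Data.Vec.Relation.Unary.All.Properties as VAll
import Data.List.Relation.Unary.Unique.DecPropositional as UDec
open import Relation.Nullary.Decidable using (_×-dec_)
open import Function using (id; _∘_; _⇔_; mk⇔; Equivalence)
open import Relation.Binary.Definitions using (DecidableEquality)
open import Relation.Binary.PropositionalEquality
open import Relation.Nullary using (¬_; Dec; yes; no; ¬?)
open import Relation.Unary using (Decidable)
open import Algebra.Properties.CommutativeSemigroup +-commutativeSemigroup using () renaming (interchange to +-interchange)
open import Algebra.Properties.CommutativeSemigroup *-commutativeSemigroup using () renaming (interchange to *-interchange)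

private variable
  A B : Set
  ℓ ℓ′ ℓ″ : Level
  P : Set ℓ
  Q : Set ℓ′
  S : Set ℓ″

∑ : List A → (A → ℕ) → ℕ
∑ []       f = 0
∑ (x ∷ xs) f = f x + ∑ xs f

infix 5 ∑
syntax ∑ L (λ x → e) = ∑[ x ← L ] e

module _ {f g : A → ℕ} where

  ∑-cong : (∀ x → f x ≡ g x) → ∀ L → ∑ L f ≡ ∑ L g
  ∑-cong f≗g []       = refl
  ∑-cong f≗g (x ∷ L) = cong₂ _+_ (f≗g x) (∑-cong f≗g L)

  ∑-mono-≤ : (∀ x → f x ≤ g x) → ∀ L → ∑ L f ≤ ∑ L g
  ∑-mono-≤ f≤g []       = z≤n
  ∑-mono-≤ f≤g (x ∷ L) = +-mono-≤ (f≤g x) (∑-mono-≤ f≤g L)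

  ∑-distrib-+ : ∀ L → ∑[ x ← L ] (f x + g x) ≡ ∑ L f + ∑ L g
  ∑-distrib-+ []       = refl
  ∑-distrib-+ (x ∷ L) =
    trans (cong (f x + g x +_) (∑-distrib-+ L)) (+-interchange (f x) (g x) (∑ L f) (∑ L g))

module _ (f : A → ℕ) where

  *-distribˡ-∑ : ∀ c L → c * ∑ L f ≡ ∑[ x ← L ] c * f x
  *-distribˡ-∑ c []       = *-zeroʳ c
  *-distribˡ-∑ c (x ∷ L) = trans (*-distribˡ-+ c (f x) (∑ L f)) (cong (c * f x +_) (*-distribˡ-∑ c L))

  *-distribʳ-∑ : ∀ c L → ∑ L f * c ≡ ∑[ x ← L ] f x * c
  *-distribʳ-∑ c L = trans (*-comm (∑ L f) c)
    (trans (*-distribˡ-∑ c L) (∑-cong (λ x → *-comm c (f x)) L))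

  ∑-++ : ∀ L M → ∑ (L ++ M) f ≡ ∑ L f + ∑ M f
  ∑-++ []       M = refl
  ∑-++ (x ∷ L) M = trans (cong (f x +_) (∑-++ L M)) (sym (+-assoc (f x) _ _))

∑-const : ∀ c (L : List A) → ∑[ _ ← L ] c ≡ length L * c
∑-const c []       = refl
∑-const c (x ∷ L) = cong (c +_) (∑-const c L)

length≡∑1 : ∀ (L : List A) → length L ≡ ∑[ _ ← L ] 1
length≡∑1 L = sym (trans (∑-const 1 L) (*-identityʳ (length L)))

∑-map : (f : B → ℕ) (g : A → B) → ∀ L → ∑ (map g L) f ≡ ∑ L (f ∘ g)
∑-map f g []       = refl
∑-map f g (x ∷ L) = cong (f (g x) +_) (∑-map f g L)

∑-concatMap : (f : B → ℕ) (g : A → List B) → ∀ L → ∑ (concatMap g L) f ≡ ∑[ x ← L ] ∑ (g x) f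
∑-concatMap f g []       = refl
∑-concatMap f g (x ∷ L) =
  trans (∑-++ f (g x) (concat (map g L))) (cong (∑ (g x) f +_) (∑-concatMap f g L))

∑-comm : (f : A → B → ℕ) → ∀ L M → ∑[ x ← L ] ∑[ y ← M ] f x y ≡ ∑[ y ← M ] ∑[ x ← L ] f x y
∑-comm f []       M = sym (trans (∑-const 0 M) (*-zeroʳ (length M)))
∑-comm f (x ∷ L) M =
  trans (cong (∑ M (f x) +_) (∑-comm f L M)) (sym (∑-distrib-+ M))

∑-cartesianProduct : (f : A × B → ℕ) → ∀ L M →
  ∑ (cartesianProduct L M) f ≡ ∑[ x ← L ] ∑[ y ← M ] f (x , y)
∑-cartesianProduct f []       M = refl
∑-cartesianProduct f (x ∷ L) M =
  trans (∑-++ f (map (x ,_) M) _) (cong₂ _+_ (∑-map f (x ,_) M) (∑-cartesianProduct f L M))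

∑-pos⇒∃ : (f : A → ℕ) → ∀ L → 1 ≤ ∑ L f → ∃ λ x → 1 ≤ f x
∑-pos⇒∃ f (x ∷ L) 1≤∑ with f x in fx≡
... | zero  = ∑-pos⇒∃ f L 1≤∑
... | suc _ = x , subst (1 ≤_) (sym fx≡) (s≤s z≤n)

𝟙 : Dec P → ℕ
𝟙 (yes _) = 1
𝟙 (no _)  = 0

𝟙-yes : (P? : Dec P) → P → 𝟙 P? ≡ 1
𝟙-yes (yes _) _  = refl
𝟙-yes (no ¬P) p = ⊥-elim (¬P p)

𝟙-no : (P? : Dec P) → ¬ P → 𝟙 P? ≡ 0
𝟙-no (yes p) ¬P = ⊥-elim (¬P p)
𝟙-no (no _)  _  = refl

𝟙≤1 : (P? : Dec P) → 𝟙 P? ≤ 1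
𝟙≤1 (yes _) = ≤-refl
𝟙≤1 (no _)  = z≤n

𝟙-mono : (P? : Dec P) (Q? : Dec Q) → (P → Q) → 𝟙 P? ≤ 𝟙 Q?
𝟙-mono (yes p) Q? P⇒Q = ≤-reflexive (sym (𝟙-yes Q? (P⇒Q p)))
𝟙-mono (no _)  Q? P⇒Q = z≤n

𝟙-cong : (P? : Dec P) (Q? : Dec Q) → P ⇔ Q → 𝟙 P? ≡ 𝟙 Q?
𝟙-cong P? Q? P⇔Q = ≤-antisym (𝟙-mono P? Q? (Equivalence.to P⇔Q)) (𝟙-mono Q? P? (Equivalence.from P⇔Q))

𝟙-idem : (P? : Dec P) → 𝟙 P? * 𝟙 P? ≡ 𝟙 P?
𝟙-idem (yes _) = refl
𝟙-idem (no _)  = refl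

𝟙-+-𝟙-¬ : (P? : Dec P) → 𝟙 P? + 𝟙 (¬? P?) ≡ 1
𝟙-+-𝟙-¬ (yes _) = refl
𝟙-+-𝟙-¬ (no _)  = refl

𝟙-*-mono : (P? : Dec P) (Q? : Dec Q) (S? : Dec S) → (P → Q → S) → 𝟙 P? * 𝟙 Q? ≤ 𝟙 S?
𝟙-*-mono (yes p) Q? S? P⇒Q⇒S = subst (_≤ 𝟙 S?) (sym (*-identityˡ (𝟙 Q?))) (𝟙-mono Q? S? (P⇒Q⇒S p))
𝟙-*-mono (no _)  Q? S? P⇒Q⇒S = z≤n

𝟙-*-pos : (P? : Dec P) (Q? : Dec Q) → 1 ≤ 𝟙 P? * 𝟙 Q? → P × Q
𝟙-*-pos (yes p) (yes q) _ = p , q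

length-filter : ∀ {p} {P : A → Set p} (P? : Decidable P) L → length (filter P? L) ≡ ∑[ x ← L ] 𝟙 (P? x)
length-filter P? []       = refl
length-filter P? (x ∷ L) with P? x
... | yes _ = cong suc (length-filter P? L)
... | no _  = length-filter P? L

module Multiplicity (_≟_ : DecidableEquality A) where

  count : A → List A → ℕ
  count x L = ∑[ y ← L ] 𝟙 (y ≟ x)

  count-∈ : ∀ {x L} → x ∈ L → 1 ≤ count x L
  count-∈ {x} {x ∷ L} (here refl) = ≤-trans (≤-reflexive (sym (𝟙-yes (x ≟ x) refl))) (m≤m+n _ (count x L))
  count-∈ (there x∈L)     = ≤-trans (count-∈ x∈L) (m≤n+m _ _)

  count-∉ : ∀ {x} L → All (x ≢_) L → count x L ≡ 0
  count-∉ []       []            = refl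
  count-∉ (y ∷ L) (x≢y ∷ x∉L) = cong₂ _+_ (𝟙-no (y ≟ _) (x≢y ∘ sym)) (count-∉ L x∉L)

  count-unique : ∀ {x} L → Unique L → count x L ≤ 1
  count-unique       []       []           = z≤n
  count-unique {x} (y ∷ L) (y∉L ∷ uL) with y ≟ x
  ... | yes refl = ≤-reflexive (cong suc (count-∉ L y∉L))
  ... | no _     = count-unique L uL

  ∑-𝟙≟-* : (g : A → ℕ) (x : A) → ∀ L → ∑[ y ← L ] 𝟙 (y ≟ x) * g y ≡ count x L * g x
  ∑-𝟙≟-* g x L = trans (∑-cong pick L) (sym (*-distribʳ-∑ (λ y → 𝟙 (y ≟ x)) (g x) L))
    where
    pick : ∀ y → 𝟙 (y ≟ x) * g y ≡ 𝟙 (y ≟ x) * g x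
    pick y with y ≟ x
    ... | yes refl = refl
    ... | no _     = refl

  Enumerates : List A → Set
  Enumerates L = ∀ x → count x L ≡ 1

  unique-complete⇒enumerates : ∀ {L} → Unique L → (∀ x → x ∈ L) → Enumerates L
  unique-complete⇒enumerates {L} uL complete x = ≤-antisym (count-unique L uL) (count-∈ (complete x))

  ∑-unique≤∑-complete : (g : A → ℕ) → ∀ {L M} → Unique L → (∀ x → x ∈ M) → ∑ L g ≤ ∑ M g
  ∑-unique≤∑-complete g {L} {M} uL complete = begin
    ∑ L g                                        ≤⟨ ∑-mono-≤ spread L ⟩
    ∑[ x ← L ] ∑[ y ← M ] 𝟙 (y ≟ x) * g y        ≡⟨ ∑-comm (λ x y → 𝟙 (y ≟ x) * g y) L M ⟩
    ∑[ y ← M ] ∑[ x ← L ] 𝟙 (y ≟ x) * g y        ≤⟨ ∑-mono-≤ collect M ⟩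
    ∑ M g                                        ∎
    where
    open ≤-Reasoning
    spread : ∀ x → g x ≤ ∑[ y ← M ] 𝟙 (y ≟ x) * g y
    spread x = begin
      g x                           ≡⟨ *-identityˡ (g x) ⟨
      1 * g x                       ≤⟨ *-monoˡ-≤ (g x) (count-∈ (complete x)) ⟩
      count x M * g x               ≡⟨ ∑-𝟙≟-* g x M ⟨
      ∑[ y ← M ] 𝟙 (y ≟ x) * g y    ∎
    collect : ∀ y → ∑[ x ← L ] 𝟙 (y ≟ x) * g y ≤ g y
    collect y = begin
      ∑[ x ← L ] 𝟙 (y ≟ x) * g y   ≡⟨ ∑-cong (λ x → cong (_* g y) (𝟙-cong (y ≟ x) (x ≟ y) (mk⇔ sym sym))) L ⟩
      ∑[ x ← L ] 𝟙 (x ≟ y) * g y   ≡⟨ sym (*-distribʳ-∑ (λ x → 𝟙 (x ≟ y)) (g y) L) ⟩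
      count y L * g y               ≤⟨ *-monoˡ-≤ (g y) (count-unique L uL) ⟩
      1 * g y                       ≡⟨ *-identityˡ (g y) ⟩
      g y                           ∎

  ∑-bijection : (g : A → ℕ) (f h : A → A) → (∀ y → f (h y) ≡ y) → (∀ x → h (f x) ≡ x) →
                ∀ {L} → Enumerates L → ∑ L (g ∘ f) ≡ ∑ L g
  ∑-bijection g f h fh hf {L} enum = begin
    ∑ L (g ∘ f)                                  ≡⟨ ∑-cong (λ x → sym (pick g (f x))) L ⟩
    ∑[ x ← L ] ∑[ y ← L ] 𝟙 (y ≟ f x) * g y      ≡⟨ ∑-comm (λ x y → 𝟙 (y ≟ f x) * g y) L L ⟩
    ∑[ y ← L ] ∑[ x ← L ] 𝟙 (y ≟ f x) * g y      ≡⟨ ∑-cong (λ y → ∑-cong (λ x → cong (_* g y) (𝟙-cong (y ≟ f x) (x ≟ h y) (inverse x y))) L) L ⟩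
    ∑[ y ← L ] ∑[ x ← L ] 𝟙 (x ≟ h y) * g y      ≡⟨ ∑-cong (λ y → pick (λ _ → g y) (h y)) L ⟩
    ∑ L g                                        ∎
    where
    open ≡-Reasoning
    pick : ∀ (g : A → ℕ) x → ∑[ y ← L ] 𝟙 (y ≟ x) * g y ≡ g x
    pick g x = trans (∑-𝟙≟-* g x L) (trans (cong (_* g x) (enum x)) (*-identityˡ (g x)))
    inverse : ∀ x y → (y ≡ f x) ⇔ (x ≡ h y)
    inverse x y = mk⇔ (λ y≡fx → trans (sym (hf x)) (cong h (sym y≡fx)))
                      (λ x≡hy → trans (sym (fh y)) (cong f (sym x≡hy)))

infixr 8 _^↓_

_^↓_ : ℕ → ℕ → ℕ
m ^↓ zero  = 1
m ^↓ suc k = m * (m ∸ 1) ^↓ k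

^↓-monoˡ-≤ : ∀ {m m′} k → m ≤ m′ → m ^↓ k ≤ m′ ^↓ k
^↓-monoˡ-≤ zero    m≤m′ = ≤-refl
^↓-monoˡ-≤ (suc k) m≤m′ = *-mono-≤ m≤m′ (^↓-monoˡ-≤ k (∸-monoˡ-≤ 1 m≤m′))

[m∸k]^k≤m^↓k : ∀ m k → (m ∸ k) ^ k ≤ m ^↓ k
[m∸k]^k≤m^↓k m zero    = ≤-refl
[m∸k]^k≤m^↓k m (suc k) = *-mono-≤ (m∸n≤m m (suc k))
  (subst (λ r → r ^ k ≤ (m ∸ 1) ^↓ k) (∸-+-assoc m 1 k) ([m∸k]^k≤m^↓k (m ∸ 1) k))

^-distribʳ-* : ∀ a b k → (a * b) ^ k ≡ a ^ k * b ^ k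
^-distribʳ-* a b zero    = refl
^-distribʳ-* a b (suc k) = trans (cong (a * b *_) (^-distribʳ-* a b k)) (*-interchange a b (a ^ k) (b ^ k))

bernoulli-step : ∀ a k → a * (a ∸ (2 + 2 * k)) ≤ (a ∸ 2) * (a ∸ 2 * k)
bernoulli-step a k with ≤-total (2 + 2 * k) a
... | inj₂ a≤2+2k = ≤-trans (≤-reflexive (trans (cong (a *_) (m≤n⇒m∸n≡0 a≤2+2k)) (*-zeroʳ a))) z≤n
... | inj₁ 2+2k≤a with m≤n⇒∃[o]m+o≡n 2+2k≤a
...   | w , refl = begin
  a * (a ∸ (2 + 2 * k))    ≡⟨ cong (a *_) (m+n∸m≡n (2 + 2 * k) w) ⟩
  a * w                    ≤⟨ m≤m+n (a * w) (4 * k) ⟩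
  a * w + 4 * k            ≡⟨ expand k w ⟩
  (2 * k + w) * (2 + w)    ≡⟨ cong₂ _*_ a∸2 a∸2k ⟨
  (a ∸ 2) * (a ∸ 2 * k)    ∎
  where
  open ≤-Reasoning
  a∸2 : 2 + 2 * k + w ∸ 2 ≡ 2 * k + w
  a∸2 = trans (cong (_∸ 2) (+-assoc 2 (2 * k) w)) (m+n∸m≡n 2 (2 * k + w))
  a∸2k : 2 + 2 * k + w ∸ 2 * k ≡ 2 + w
  a∸2k = trans (cong (λ j → j + w ∸ 2 * k) (+-comm 2 (2 * k))) (trans (cong (_∸ 2 * k) (+-assoc (2 * k) 2 w)) (m+n∸m≡n (2 * k) (2 + w)))
  expand : ∀ k w → (2 + 2 * k + w) * w + 4 * k ≡ (2 * k + w) * (2 + w)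
  expand = solve-∀

bernoulli : ∀ a k → a ^ k * (a ∸ 2 * k) ≤ a * (a ∸ 2) ^ k
bernoulli a zero    = ≤-reflexive (trans (*-identityˡ a) (sym (*-identityʳ a)))
bernoulli a (suc k) = begin
  a * a ^ k * (a ∸ 2 * suc k)         ≡⟨ cong (λ j → a * a ^ k * (a ∸ j)) (*-suc 2 k) ⟩
  a * a ^ k * (a ∸ (2 + 2 * k))       ≡⟨ e₁ a (a ^ k) (a ∸ (2 + 2 * k)) ⟩
  a ^ k * (a * (a ∸ (2 + 2 * k)))     ≤⟨ *-monoʳ-≤ (a ^ k) (bernoulli-step a k) ⟩
  a ^ k * ((a ∸ 2) * (a ∸ 2 * k))     ≡⟨ e₂ (a ^ k) (a ∸ 2) (a ∸ 2 * k) ⟩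
  (a ∸ 2) * (a ^ k * (a ∸ 2 * k))     ≤⟨ *-monoʳ-≤ (a ∸ 2) (bernoulli a k) ⟩
  (a ∸ 2) * (a * (a ∸ 2) ^ k)         ≡⟨ e₂ (a ∸ 2) a ((a ∸ 2) ^ k) ⟩
  a * ((a ∸ 2) * (a ∸ 2) ^ k)         ∎
  where
  open ≤-Reasoning
  e₁ : ∀ a x y → a * x * y ≡ x * (a * y)
  e₁ = solve-∀
  e₂ : ∀ x b c → x * (b * c) ≡ b * (x * c)
  e₂ = solve-∀

3*[8k]^k≤4*[8k∸2]^k : ∀ k → 1 ≤ k → 3 * (8 * k) ^ k ≤ 4 * (8 * k ∸ 2) ^ k
3*[8k]^k≤4*[8k∸2]^k k 1≤k = *-cancelˡ-≤ (2 * k) {{>-nonZero (≤-trans 1≤k (m≤n*m k 2))}} (begin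
  2 * k * (3 * (8 * k) ^ k)          ≡⟨ e₁ k ((8 * k) ^ k) ⟩
  (8 * k) ^ k * (6 * k)              ≡⟨ cong ((8 * k) ^ k *_) 8k∸2k ⟨
  (8 * k) ^ k * (8 * k ∸ 2 * k)      ≤⟨ bernoulli (8 * k) k ⟩
  8 * k * (8 * k ∸ 2) ^ k            ≡⟨ e₂ k ((8 * k ∸ 2) ^ k) ⟩
  2 * k * (4 * (8 * k ∸ 2) ^ k)      ∎)
  where
  open ≤-Reasoning
  8k∸2k : 8 * k ∸ 2 * k ≡ 6 * k
  8k∸2k = trans (cong (_∸ 2 * k) (e₀ k)) (m+n∸m≡n (2 * k) (6 * k))
    where
    e₀ : ∀ k → 8 * k ≡ 2 * k + 6 * k
    e₀ = solve-∀
  e₁ : ∀ k x → 2 * k * (3 * x) ≡ x * (6 * k)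
  e₁ = solve-∀
  e₂ : ∀ k y → 8 * k * y ≡ 2 * k * (4 * y)
  e₂ = solve-∀

[a∸b]²+2ab≤b²+a² : ∀ a b → (a ∸ b) * (a ∸ b) + 2 * a * b ≤ b * b + a * a
[a∸b]²+2ab≤b²+a² a b with ≤-total b a
... | inj₁ b≤a with m≤n⇒∃[o]m+o≡n b≤a
...   | r , refl rewrite m+n∸m≡n b r = ≤-reflexive (expand b r)
  where
  expand : ∀ x y → y * y + 2 * (x + y) * x ≡ x * x + (x + y) * (x + y)
  expand = solve-∀
[a∸b]²+2ab≤b²+a² a b | inj₂ a≤b with m≤n⇒∃[o]m+o≡n a≤b
...   | r , refl rewrite m≤n⇒m∸n≡0 (m≤m+n a r) = ≤-trans (m≤n+m _ (r * r)) (≤-reflexive (expand a r))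
  where
  expand : ∀ x y → y * y + 2 * x * (x + y) ≡ (x + y) * (x + y) + x * x
  expand = solve-∀

-- W, X and Y play the roles of ∑ (n ∸ q δ)², q ∑ δ and q² ∑ δ² for a function δ
-- on a set of P points.
variance-from-moments : ∀ {W X Y P n q} → 2 ≤ q → n * P ≤ X + P → Y ≤ n * (n * P) + n * (q * P) →
                        W + 2 * n * X ≤ Y + P * (n * n) → W ≤ 2 * n * (q * P)
variance-from-moments {W} {X} {Y} {P} {n} {q} 2≤q first second centred =
  +-cancelʳ-≤ (2 * n * (n * P)) W (2 * n * (q * P)) (begin
    W + 2 * n * (n * P)                                   ≤⟨ +-monoʳ-≤ W (*-monoʳ-≤ (2 * n) first) ⟩
    W + 2 * n * (X + P)                                   ≡⟨ e₁ W n X P ⟩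
    (W + 2 * n * X) + 2 * n * P                           ≤⟨ +-monoˡ-≤ (2 * n * P) centred ⟩
    Y + P * (n * n) + 2 * n * P                           ≤⟨ +-monoˡ-≤ (2 * n * P) (+-monoˡ-≤ (P * (n * n)) second) ⟩
    n * (n * P) + n * (q * P) + P * (n * n) + 2 * n * P   ≡⟨ e₂ n P q ⟩
    n * (q * P) + n * (2 * P) + 2 * n * (n * P)           ≤⟨ +-monoˡ-≤ (2 * n * (n * P)) (+-monoʳ-≤ (n * (q * P)) (*-monoʳ-≤ n (*-monoˡ-≤ P 2≤q))) ⟩
    n * (q * P) + n * (q * P) + 2 * n * (n * P)           ≡⟨ cong (_+ 2 * n * (n * P)) (e₃ n q P) ⟩
    2 * n * (q * P) + 2 * n * (n * P)                     ∎)
  where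
  open ≤-Reasoning
  e₁ : ∀ W n X P → W + 2 * n * (X + P) ≡ (W + 2 * n * X) + 2 * n * P
  e₁ = solve-∀
  e₂ : ∀ n P q → n * (n * P) + n * (q * P) + P * (n * n) + 2 * n * P ≡ n * (q * P) + n * (2 * P) + 2 * n * (n * P)
  e₂ = solve-∀
  e₃ : ∀ n q P → n * (q * P) + n * (q * P) ≡ 2 * n * (q * P)
  e₃ = solve-∀

-- a = 8k makes (1 − 2/a)ᵏ ≥ 3/4 by Bernoulli's inequality, and C = 20k leaves
-- at most n/3 elements outside Good.
module _ {A : Set} {E : List A} (m : A → ℕ) {q P k : ℕ} (1≤k : 1 ≤ k) (1≤q : 1 ≤ q) (1≤P : 1 ≤ P)
         (n≤P : length E ≤ P)
         (centred : ∑[ y ← E ] (length E ∸ q * m y) * (length E ∸ q * m y) ≤ 2 * length E * (q * P))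
         (large : 20 * k * (20 * k) * (q * P) ≤ length E * length E) where

  private
    n a C : ℕ
    n = length E
    a = 8 * k
    C = 20 * k

    1≤n : 1 ≤ n
    1≤n = 1≤m*m⇒1≤m n (≤-trans 1≤C²qP large)
      where
      1≤m*m⇒1≤m : ∀ m → 1 ≤ m * m → 1 ≤ m
      1≤m*m⇒1≤m (suc _) _ = s≤s z≤n
      1≤C : 1 ≤ C
      1≤C = ≤-trans 1≤k (m≤n*m k 20)
      1≤C²qP : 1 ≤ C * C * (q * P)
      1≤C²qP = *-mono-≤ (*-mono-≤ 1≤C 1≤C) (*-mono-≤ 1≤q 1≤P)

    instance
      n≢0 : NonZero n
      n≢0 = >-nonZero 1≤n

    aqk≤n : a * q * k ≤ n
    aqk≤n = *-cancelʳ-≤ (a * q * k) n n (begin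
      a * q * k * n          ≤⟨ *-monoʳ-≤ (a * q * k) n≤P ⟩
      a * q * k * P          ≡⟨ e k q P ⟩
      8 * k * k * (q * P)    ≤⟨ *-monoˡ-≤ (q * P) (*-mono-≤ (*-monoˡ-≤ k (m≤m+n 8 12)) (m≤n*m k 20)) ⟩
      C * C * (q * P)        ≤⟨ large ⟩
      n * n                  ∎)
      where
      open ≤-Reasoning
      e : ∀ k q P → 8 * k * q * k * P ≡ 8 * k * k * (q * P)
      e = solve-∀

    2≤a : 2 ≤ a
    2≤a = ≤-trans (s≤s (s≤s z≤n)) (*-monoʳ-≤ 8 1≤k)

    Good : A → Set
    Good y = (a ∸ 2) * n ≤ a * q * (m y ∸ k)

    good? : Decidable Good
    good? y = (a ∸ 2) * n ≤? a * q * (m y ∸ k)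

    #good #bad : ℕ
    #good = ∑[ y ← E ] 𝟙 (good? y)
    #bad  = ∑[ y ← E ] 𝟙 (¬? (good? y))

    far-from-mean : ∀ y → ¬ Good y → n ≤ a * (n ∸ q * m y)
    far-from-mean y bad = begin
      n                                   ≡⟨ m+n∸m≡n (a * (q * m y)) n ⟨
      a * (q * m y) + n ∸ a * (q * m y)   ≤⟨ ∸-monoˡ-≤ (a * (q * m y)) aqm+n≤an ⟩
      a * n ∸ a * (q * m y)               ≡⟨ *-distribˡ-∸ a n (q * m y) ⟨
      a * (n ∸ q * m y)                   ∎
      where
      open ≤-Reasoning
      aqm+n≤an : a * (q * m y) + n ≤ a * n
      aqm+n≤an = begin
        a * (q * m y) + n                     ≡⟨ cong (_+ n) (*-assoc a q (m y)) ⟨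
        a * q * m y + n                       ≤⟨ +-monoˡ-≤ n (*-monoʳ-≤ (a * q) (m≤n+m∸n (m y) k)) ⟩
        a * q * (k + (m y ∸ k)) + n           ≡⟨ cong (_+ n) (*-distribˡ-+ (a * q) k (m y ∸ k)) ⟩
        a * q * k + a * q * (m y ∸ k) + n     ≤⟨ +-monoˡ-≤ n (+-mono-≤ aqk≤n (<⇒≤ (≰⇒> bad))) ⟩
        n + (a ∸ 2) * n + n                   ≡⟨ e (a ∸ 2) n ⟩
        (a ∸ 2 + 2) * n                       ≡⟨ cong (_* n) (m∸n+n≡m 2≤a) ⟩
        a * n                                 ∎
        where
        e : ∀ b n → n + b * n + n ≡ (b + 2) * n
        e = solve-∀

    n²*𝟙bad≤ : ∀ y → n * n * 𝟙 (¬? (good? y)) ≤ a * a * ((n ∸ q * m y) * (n ∸ q * m y))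
    n²*𝟙bad≤ y = by-cases (good? y)
      where
      by-cases : (g : Dec (Good y)) → n * n * 𝟙 (¬? g) ≤ a * a * ((n ∸ q * m y) * (n ∸ q * m y))
      by-cases (yes _)  = ≤-trans (≤-reflexive (*-zeroʳ (n * n))) z≤n
      by-cases (no bad) = ≤-trans (≤-reflexive (*-identityʳ (n * n)))
        (≤-trans (*-mono-≤ (far-from-mean y bad) (far-from-mean y bad)) (≤-reflexive (*-interchange a _ a _)))

    3*#bad≤n : 3 * #bad ≤ n
    3*#bad≤n = *-cancelˡ-≤ (128 * (k * k) * (n * n)) {{>-nonZero 1≤128k²n²}} (begin
      128 * (k * k) * (n * n) * (3 * #bad)            ≡⟨ e₁ k n #bad ⟩
      384 * (k * k) * (n * n * #bad)                  ≤⟨ *-monoˡ-≤ (n * n * #bad) (*-monoˡ-≤ (k * k) (m≤m+n 384 16)) ⟩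
      400 * (k * k) * (n * n * #bad)                  ≤⟨ *-monoʳ-≤ (400 * (k * k)) n²#bad≤ ⟩
      400 * (k * k) * (a * a * (2 * n * (q * P)))     ≡⟨ e₂ k n q P ⟩
      128 * (k * k) * n * (C * C * (q * P))           ≤⟨ *-monoʳ-≤ (128 * (k * k) * n) large ⟩
      128 * (k * k) * n * (n * n)                     ≡⟨ e₃ k n ⟩
      128 * (k * k) * (n * n) * n                     ∎)
      where
      open ≤-Reasoning
      1≤128k²n² : 1 ≤ 128 * (k * k) * (n * n)
      1≤128k²n² = *-mono-≤ (*-mono-≤ {1} {128} (s≤s z≤n) (*-mono-≤ 1≤k 1≤k)) (*-mono-≤ 1≤n 1≤n)
      n²#bad≤ : n * n * #bad ≤ a * a * (2 * n * (q * P))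
      n²#bad≤ = begin
        n * n * #bad                                           ≡⟨ *-distribˡ-∑ _ (n * n) E ⟩
        ∑[ y ← E ] n * n * 𝟙 (¬? (good? y))                    ≤⟨ ∑-mono-≤ n²*𝟙bad≤ E ⟩
        ∑[ y ← E ] a * a * ((n ∸ q * m y) * (n ∸ q * m y))     ≡⟨ *-distribˡ-∑ _ (a * a) E ⟨
        a * a * (∑[ y ← E ] (n ∸ q * m y) * (n ∸ q * m y))     ≤⟨ *-monoʳ-≤ (a * a) centred ⟩
        a * a * (2 * n * (q * P))                              ∎
      e₁ : ∀ k n b → 128 * (k * k) * (n * n) * (3 * b) ≡ 384 * (k * k) * (n * n * b)
      e₁ = solve-∀
      e₂ : ∀ k n q P → 400 * (k * k) * (8 * k * (8 * k) * (2 * n * (q * P))) ≡ 128 * (k * k) * n * (20 * k * (20 * k) * (q * P))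
      e₂ = solve-∀
      e₃ : ∀ k n → 128 * (k * k) * n * (n * n) ≡ 128 * (k * k) * (n * n) * n
      e₃ = solve-∀

    2n≤3*#good : 2 * n ≤ 3 * #good
    2n≤3*#good = +-cancelʳ-≤ (3 * #bad) (2 * n) (3 * #good) (begin
      2 * n + 3 * #bad          ≤⟨ +-monoʳ-≤ (2 * n) 3*#bad≤n ⟩
      2 * n + n                 ≡⟨ +-comm (2 * n) n ⟩
      3 * n                     ≡⟨ cong (3 *_) #good+#bad≡n ⟨
      3 * (#good + #bad)        ≡⟨ *-distribˡ-+ 3 #good #bad ⟩
      3 * #good + 3 * #bad      ∎)
      where
      open ≤-Reasoning
      #good+#bad≡n : #good + #bad ≡ n
      #good+#bad≡n = trans (sym (∑-distrib-+ E)) (trans (∑-cong (λ y → 𝟙-+-𝟙-¬ (good? y)) E) (sym (length≡∑1 E)))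

    #good*bound≤ : #good * ((a ∸ 2) * n) ^ k ≤ (a * q) ^ k * (∑[ y ← E ] m y ^↓ k)
    #good*bound≤ = begin
      #good * ((a ∸ 2) * n) ^ k                       ≡⟨ *-distribʳ-∑ _ _ E ⟩
      ∑[ y ← E ] 𝟙 (good? y) * ((a ∸ 2) * n) ^ k     ≤⟨ ∑-mono-≤ (λ y → by-cases y (good? y)) E ⟩
      ∑[ y ← E ] (a * q) ^ k * m y ^↓ k              ≡⟨ *-distribˡ-∑ _ ((a * q) ^ k) E ⟨
      (a * q) ^ k * (∑[ y ← E ] m y ^↓ k)            ∎
      where
      open ≤-Reasoning
      by-cases : ∀ y (g : Dec (Good y)) → 𝟙 g * ((a ∸ 2) * n) ^ k ≤ (a * q) ^ k * m y ^↓ k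
      by-cases y (no _)     = z≤n
      by-cases y (yes good) = begin
        1 * ((a ∸ 2) * n) ^ k              ≡⟨ *-identityˡ _ ⟩
        ((a ∸ 2) * n) ^ k                  ≤⟨ ^-monoˡ-≤ k good ⟩
        (a * q * (m y ∸ k)) ^ k            ≡⟨ ^-distribʳ-* (a * q) (m y ∸ k) k ⟩
        (a * q) ^ k * (m y ∸ k) ^ k        ≤⟨ *-monoʳ-≤ ((a * q) ^ k) ([m∸k]^k≤m^↓k (m y) k) ⟩
        (a * q) ^ k * m y ^↓ k             ∎

  ∑^↓-lower-bound : length E ^ (k + 1) ≤ 2 * q ^ k * (∑[ y ← E ] m y ^↓ k)
  ∑^↓-lower-bound = *-cancelˡ-≤ (4 * a ^ k) {{>-nonZero 1≤4a^k}} (begin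
    4 * a ^ k * n ^ (k + 1)                  ≡⟨ cong (4 * a ^ k *_) (trans (^-distribˡ-+-* n k 1) (cong (n ^ k *_) (*-identityʳ n))) ⟩
    4 * a ^ k * (n ^ k * n)                  ≡⟨ e₁ (a ^ k) (n ^ k) n ⟩
    2 * a ^ k * n ^ k * (2 * n)              ≤⟨ *-monoʳ-≤ (2 * a ^ k * n ^ k) 2n≤3*#good ⟩
    2 * a ^ k * n ^ k * (3 * #good)          ≡⟨ e₂ (a ^ k) (n ^ k) #good ⟩
    2 * #good * n ^ k * (3 * a ^ k)          ≤⟨ *-monoʳ-≤ (2 * #good * n ^ k) (3*[8k]^k≤4*[8k∸2]^k k 1≤k) ⟩
    2 * #good * n ^ k * (4 * (a ∸ 2) ^ k)    ≡⟨ e₃ #good (n ^ k) ((a ∸ 2) ^ k) ⟩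
    8 * (#good * ((a ∸ 2) ^ k * n ^ k))      ≡⟨ cong (λ x → 8 * (#good * x)) (^-distribʳ-* (a ∸ 2) n k) ⟨
    8 * (#good * ((a ∸ 2) * n) ^ k)          ≤⟨ *-monoʳ-≤ 8 #good*bound≤ ⟩
    8 * ((a * q) ^ k * ∑m^↓k)                ≡⟨ cong (λ x → 8 * (x * ∑m^↓k)) (^-distribʳ-* a q k) ⟩
    8 * (a ^ k * q ^ k * ∑m^↓k)              ≡⟨ e₄ (a ^ k) (q ^ k) ∑m^↓k ⟩
    4 * a ^ k * (2 * q ^ k * ∑m^↓k)          ∎)
    where
    open ≤-Reasoning
    ∑m^↓k = ∑[ y ← E ] m y ^↓ k
    1≤4a^k : 1 ≤ 4 * a ^ k
    1≤4a^k = *-mono-≤ {1} {4} (s≤s z≤n) (≤-trans (≤-reflexive (sym (^-zeroˡ k))) (^-monoˡ-≤ k (≤-trans (s≤s z≤n) 2≤a)))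
    e₁ : ∀ x y n → 4 * x * (y * n) ≡ 2 * x * y * (2 * n)
    e₁ = solve-∀
    e₂ : ∀ x y g → 2 * x * y * (3 * g) ≡ 2 * g * y * (3 * x)
    e₂ = solve-∀
    e₃ : ∀ g y b → 2 * g * y * (4 * b) ≡ 8 * (g * (b * y))
    e₃ = solve-∀
    e₄ : ∀ x p s → 8 * (x * p * s) ≡ 4 * x * (2 * p * s)
    e₄ = solve-∀

module _ (F : FiniteField) where

  private module F = FiniteField F
  open F using (Carrier; 0#; 1#; -_; ≈⇒≡; elements; order)
    renaming (_+_ to _+ᶠ_; _*_ to _*ᶠ_; _-_ to _-ᶠ_)
  open import Algebra.Properties.Group F.+-group using (//-rightDividesˡ; //-rightDividesʳ; x∙y⁻¹≈ε⇒x≈y; x≈y⇒x∙y⁻¹≈ε)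
  open import Algebra.Properties.AbelianGroup F.+-abelianGroup using (⁻¹-∙-comm)
  open import Algebra.Properties.RingWithoutOne (Ring.ringWithoutOne F.ring) using (x[y-z]≈xy-xz)
  open import Algebra.Properties.CommutativeSemigroup F.+-commutativeSemigroup
    renaming (interchange to +ᶠ-interchange)

  +ᶠ-moveˡ : ∀ {x y s} → (x +ᶠ y ≡ s) ⇔ (y ≡ s -ᶠ x)
  +ᶠ-moveˡ {x} {y} {s} = mk⇔
    (λ x+y≡s → trans (sym (≈⇒≡ (//-rightDividesʳ x y))) (cong (_-ᶠ x) (trans (≈⇒≡ (F.+-comm y x)) x+y≡s)))
    (λ y≡s-x → trans (≈⇒≡ (F.+-comm x y)) (trans (cong (_+ᶠ x) y≡s-x) (≈⇒≡ (//-rightDividesˡ x s))))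

  x-y≡0⇔x≡y : ∀ {x y} → (x -ᶠ y ≡ 0#) ⇔ (x ≡ y)
  x-y≡0⇔x≡y {x} {y} = mk⇔ (λ x-y≡0 → ≈⇒≡ (x∙y⁻¹≈ε⇒x≈y x y (F.reflexive x-y≡0)))
                          (λ x≡y → ≈⇒≡ (x≈y⇒x∙y⁻¹≈ε (F.reflexive x≡y)))

  *ᶠ-moveʳ : ∀ {a b b′ s} → b *ᶠ b′ ≡ 1# → (a *ᶠ b ≡ s) ⇔ (a ≡ s *ᶠ b′)
  *ᶠ-moveʳ {a} {b} {b′} {s} bb′≡1 = mk⇔
    (λ ab≡s → begin
      a                ≡⟨ ≈⇒≡ (F.*-identityʳ a) ⟨
      a *ᶠ 1#          ≡⟨ cong (a *ᶠ_) bb′≡1 ⟨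
      a *ᶠ (b *ᶠ b′)   ≡⟨ ≈⇒≡ (F.*-assoc a b b′) ⟨
      (a *ᶠ b) *ᶠ b′   ≡⟨ cong (_*ᶠ b′) ab≡s ⟩
      s *ᶠ b′          ∎)
    (λ a≡sb′ → begin
      a *ᶠ b           ≡⟨ cong (_*ᶠ b) a≡sb′ ⟩
      (s *ᶠ b′) *ᶠ b   ≡⟨ ≈⇒≡ (F.*-assoc s b′ b) ⟩
      s *ᶠ (b′ *ᶠ b)   ≡⟨ cong (s *ᶠ_) (trans (≈⇒≡ (F.*-comm b′ b)) bb′≡1) ⟩
      s *ᶠ 1#          ≡⟨ ≈⇒≡ (F.*-identityʳ s) ⟩
      s                ∎)
    where open ≡-Reasoning

  *ᶠ-cancelˡ : ∀ {l l′ a b} → l *ᶠ l′ ≡ 1# → l *ᶠ a ≡ l *ᶠ b → a ≡ b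
  *ᶠ-cancelˡ {l} {l′} {a} {b} ll′≡1 la≡lb = begin
    a                ≡⟨ ≈⇒≡ (F.*-identityˡ a) ⟨
    1# *ᶠ a          ≡⟨ cong (_*ᶠ a) l′l≡1 ⟨
    (l′ *ᶠ l) *ᶠ a   ≡⟨ ≈⇒≡ (F.*-assoc l′ l a) ⟩
    l′ *ᶠ (l *ᶠ a)   ≡⟨ cong (l′ *ᶠ_) la≡lb ⟩
    l′ *ᶠ (l *ᶠ b)   ≡⟨ ≈⇒≡ (F.*-assoc l′ l b) ⟨
    (l′ *ᶠ l) *ᶠ b   ≡⟨ cong (_*ᶠ b) l′l≡1 ⟩
    1# *ᶠ b          ≡⟨ ≈⇒≡ (F.*-identityˡ b) ⟩
    b                ∎
    where
    open ≡-Reasoning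
    l′l≡1 : l′ *ᶠ l ≡ 1#
    l′l≡1 = trans (≈⇒≡ (F.*-comm l′ l)) ll′≡1

  private variable
    d : ℕ

  0ᵛ : Vec Carrier d
  0ᵛ = V.replicate _ 0#

  infixl 6 _+ᵛ_ _-ᵛ_
  infixr 7 _*ᵛ_

  _+ᵛ_ _-ᵛ_ : Vec Carrier d → Vec Carrier d → Vec Carrier d
  _+ᵛ_ = V.zipWith _+ᶠ_
  _-ᵛ_ = V.zipWith _-ᶠ_

  _*ᵛ_ : Carrier → Vec Carrier d → Vec Carrier d
  l *ᵛ v = V.map (l *ᶠ_) v

  _·_ : Vec Carrier d → Vec Carrier d → Carrier
  _·_ = dot F

  ·-zeroʳ : (v : Vec Carrier d) → v · 0ᵛ ≡ 0#
  ·-zeroʳ []       = refl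
  ·-zeroʳ (a ∷ v) = trans (cong₂ _+ᶠ_ (≈⇒≡ (F.zeroʳ a)) (·-zeroʳ v)) (≈⇒≡ (F.+-identityʳ 0#))

  ·-*ᵛˡ : ∀ l (v w : Vec Carrier d) → (l *ᵛ v) · w ≡ l *ᶠ (v · w)
  ·-*ᵛˡ l []       []       = sym (≈⇒≡ (F.zeroʳ l))
  ·-*ᵛˡ l (a ∷ v) (b ∷ w) =
    trans (cong₂ _+ᶠ_ (≈⇒≡ (F.*-assoc l a b)) (·-*ᵛˡ l v w)) (sym (≈⇒≡ (F.distribˡ l (a *ᶠ b) (v · w))))

  ·-+ᵛˡ : (v u w : Vec Carrier d) → (v +ᵛ u) · w ≡ v · w +ᶠ u · w
  ·-+ᵛˡ []       []       []       = sym (≈⇒≡ (F.+-identityʳ 0#))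
  ·-+ᵛˡ (a ∷ v) (c ∷ u) (b ∷ w) =
    trans (cong₂ _+ᶠ_ (≈⇒≡ (F.distribʳ b a c)) (·-+ᵛˡ v u w)) (≈⇒≡ (+ᶠ-interchange (a *ᶠ b) (c *ᶠ b) (v · w) (u · w)))

  ·--ᵛʳ : (v y z : Vec Carrier d) → v · (y -ᵛ z) ≡ v · y -ᶠ v · z
  ·--ᵛʳ []       []       []       = sym (≈⇒≡ (F.-‿inverseʳ 0#))
  ·--ᵛʳ (a ∷ v) (b ∷ y) (c ∷ z) = begin
    a *ᶠ (b -ᶠ c) +ᶠ v · (y -ᵛ z)               ≡⟨ cong₂ _+ᶠ_ (≈⇒≡ (x[y-z]≈xy-xz a b c)) (·--ᵛʳ v y z) ⟩
    (a *ᶠ b -ᶠ a *ᶠ c) +ᶠ (v · y -ᶠ v · z)       ≡⟨ ≈⇒≡ (+ᶠ-interchange (a *ᶠ b) (- (a *ᶠ c)) (v · y) (- (v · z))) ⟩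
    (a *ᶠ b +ᶠ v · y) +ᶠ (- (a *ᶠ c) +ᶠ - (v · z)) ≡⟨ cong ((a *ᶠ b +ᶠ v · y) +ᶠ_) (≈⇒≡ (⁻¹-∙-comm (a *ᶠ c) (v · z))) ⟩
    (a *ᶠ b +ᶠ v · y) -ᶠ (a *ᶠ c +ᶠ v · z)       ∎
    where open ≡-Reasoning

  -ᵛ-+ᵛ : (v u : Vec Carrier d) → (v -ᵛ u) +ᵛ u ≡ v
  -ᵛ-+ᵛ []       []       = refl
  -ᵛ-+ᵛ (a ∷ v) (b ∷ u) = cong₂ _∷_ (≈⇒≡ (//-rightDividesˡ b a)) (-ᵛ-+ᵛ v u)

  +ᵛ--ᵛ : (v u : Vec Carrier d) → (v +ᵛ u) -ᵛ u ≡ v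
  +ᵛ--ᵛ []       []       = refl
  +ᵛ--ᵛ (a ∷ v) (b ∷ u) = cong₂ _∷_ (≈⇒≡ (//-rightDividesʳ b a)) (+ᵛ--ᵛ v u)

  *ᵛ-inverse : ∀ {l l′} → l *ᶠ l′ ≡ 1# → (v : Vec Carrier d) → l *ᵛ l′ *ᵛ v ≡ v
  *ᵛ-inverse ll′≡1 []       = refl
  *ᵛ-inverse {l = l} {l′} ll′≡1 (a ∷ v) =
    cong₂ _∷_ (trans (sym (≈⇒≡ (F.*-assoc l l′ a))) (trans (cong (_*ᶠ a) ll′≡1) (≈⇒≡ (F.*-identityˡ a))))
              (*ᵛ-inverse ll′≡1 v)

  -ᵛ≡0⇒≡ : (y z : Vec Carrier d) → y -ᵛ z ≡ 0ᵛ → y ≡ z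
  -ᵛ≡0⇒≡ []       []       _ = refl
  -ᵛ≡0⇒≡ (b ∷ y) (c ∷ z) y-z≡0 =
    cong₂ _∷_ (Equivalence.to x-y≡0⇔x≡y (VP.∷-injectiveˡ y-z≡0)) (-ᵛ≡0⇒≡ y z (VP.∷-injectiveʳ y-z≡0))

  infix 4 _≟ᶠ_ _≟ᵛ_
  infix 7 _·_

  _≟ᶠ_ : DecidableEquality Carrier
  _≟ᶠ_ = F._≟F_

  private module Fᴹ = Multiplicity _≟ᶠ_

  _≟ᵛ_ : DecidableEquality (Vec Carrier d)
  _≟ᵛ_ = VP.≡-dec F._≟F_

  private module Vᴹ {d} = Multiplicity (_≟ᵛ_ {d})

  elements-enumerate : Fᴹ.Enumerates elements
  elements-enumerate = Fᴹ.unique-complete⇒enumerates F.distinct F.complete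

  2≤order : 2 ≤ order
  2≤order = begin
    2                                                ≡⟨ cong₂ _+_ (elements-enumerate 0#) (elements-enumerate 1#) ⟨
    Fᴹ.count 0# elements + Fᴹ.count 1# elements      ≡⟨ ∑-distrib-+ elements ⟨
    ∑[ x ← elements ] (𝟙 (x ≟ᶠ 0#) + 𝟙 (x ≟ᶠ 1#))    ≤⟨ ∑-mono-≤ at-most-one elements ⟩
    ∑[ _ ← elements ] 1                              ≡⟨ length≡∑1 elements ⟨
    order                                            ∎
    where
    open ≤-Reasoning
    at-most-one : ∀ x → 𝟙 (x ≟ᶠ 0#) + 𝟙 (x ≟ᶠ 1#) ≤ 1
    at-most-one x with x ≟ᶠ 0# | x ≟ᶠ 1#
    ... | yes refl | yes 0≡1 = ⊥-elim (F.0≢1 0≡1)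
    ... | yes _    | no _    = ≤-refl
    ... | no _     | x≟1     = 𝟙≤1 x≟1

  vectors : ∀ d → List (Vec Carrier d)
  vectors d = tuples F elements d

  ∑-vectors-suc : (f : Vec Carrier (suc d) → ℕ) →
                  ∑ (vectors (suc d)) f ≡ ∑[ a ← elements ] ∑[ v ← vectors d ] f (a ∷ v)
  ∑-vectors-suc {d} f = trans (∑-concatMap f (λ a → map (a ∷_) (vectors d)) elements)
                              (∑-cong (λ a → ∑-map f (a ∷_) (vectors d)) elements)

  length-vectors : ∀ d → length (vectors d) ≡ order ^ d
  length-vectors zero    = refl
  length-vectors (suc d) = begin
    length (vectors (suc d))                      ≡⟨ length≡∑1 (vectors (suc d)) ⟩
    ∑[ _ ← vectors (suc d) ] 1                    ≡⟨ ∑-vectors-suc (λ _ → 1) ⟩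
    ∑[ _ ← elements ] ∑[ _ ← vectors d ] 1        ≡⟨ ∑-cong (λ _ → trans (sym (length≡∑1 (vectors d))) (length-vectors d)) elements ⟩
    ∑[ _ ← elements ] order ^ d                   ≡⟨ ∑-const (order ^ d) elements ⟩
    order * order ^ d                             ∎
    where open ≡-Reasoning

  ∈-vectors : (v : Vec Carrier d) → v ∈ vectors d
  ∈-vectors []       = here refl
  ∈-vectors (a ∷ v) = ∈.∈-concatMap⁺ (λ b → map (b ∷_) (vectors _))
    (Any.map (λ { refl → ∈.∈-map⁺ (a ∷_) (∈-vectors v) }) (F.complete a))

  vectors-enumerate : ∀ d → Vᴹ.Enumerates (vectors d)
  vectors-enumerate zero    [] = refl
  vectors-enumerate (suc d) (a ∷ v) = begin
    ∑[ w ← vectors (suc d) ] 𝟙 (w ≟ᵛ (a ∷ v))                   ≡⟨ ∑-vectors-suc (λ w → 𝟙 (w ≟ᵛ (a ∷ v))) ⟩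
    ∑[ b ← elements ] ∑[ w ← vectors d ] 𝟙 ((b ∷ w) ≟ᵛ (a ∷ v))  ≡⟨ ∑-cong (λ b → ∑-cong (𝟙-∷ b) (vectors d)) elements ⟩
    ∑[ b ← elements ] ∑[ w ← vectors d ] 𝟙 (b ≟ᶠ a) * 𝟙 (w ≟ᵛ v)  ≡⟨ ∑-cong (λ b → *-distribˡ-∑ _ (𝟙 (b ≟ᶠ a)) (vectors d)) elements ⟨
    ∑[ b ← elements ] 𝟙 (b ≟ᶠ a) * Vᴹ.count v (vectors d)        ≡⟨ ∑-cong (λ b → cong (𝟙 (b ≟ᶠ a) *_) (vectors-enumerate d v)) elements ⟩
    ∑[ b ← elements ] 𝟙 (b ≟ᶠ a) * 1                              ≡⟨ ∑-cong (λ b → *-identityʳ (𝟙 (b ≟ᶠ a))) elements ⟩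
    Fᴹ.count a elements                                           ≡⟨ elements-enumerate a ⟩
    1                                                             ∎
    where
    open ≡-Reasoning
    𝟙-∷ : ∀ b w → 𝟙 ((b ∷ w) ≟ᵛ (a ∷ v)) ≡ 𝟙 (b ≟ᶠ a) * 𝟙 (w ≟ᵛ v)
    𝟙-∷ b w = split (b ≟ᶠ a) (w ≟ᵛ v)
      where
      split : (b≟a : Dec (b ≡ a)) (w≟v : Dec (w ≡ v)) → 𝟙 ((b ∷ w) ≟ᵛ (a ∷ v)) ≡ 𝟙 b≟a * 𝟙 w≟v
      split (yes b≡a) (yes w≡v) = 𝟙-yes ((b ∷ w) ≟ᵛ (a ∷ v)) (cong₂ _∷_ b≡a w≡v)
      split (yes _)   (no w≢v)  = 𝟙-no ((b ∷ w) ≟ᵛ (a ∷ v)) (w≢v ∘ VP.∷-injectiveʳ)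
      split (no b≢a)  _         = 𝟙-no ((b ∷ w) ≟ᵛ (a ∷ v)) (b≢a ∘ VP.∷-injectiveˡ)

  hyperplaneSize : Vec Carrier d → Carrier → ℕ
  hyperplaneSize {d} w s = ∑[ v ← vectors d ] 𝟙 (v · w ≟ᶠ s)

  hyperplaneSize-∷ : ∀ b (w : Vec Carrier d) s →
                     hyperplaneSize (b ∷ w) s ≡ ∑[ a ← elements ] hyperplaneSize w (s -ᶠ a *ᶠ b)
  hyperplaneSize-∷ {d} b w s = trans (∑-vectors-suc (λ v → 𝟙 (v · (b ∷ w) ≟ᶠ s)))
    (∑-cong (λ a → ∑-cong (λ v → 𝟙-cong (_ ≟ᶠ s) (v · w ≟ᶠ _) +ᶠ-moveˡ) (vectors d)) elements)

  hyperplaneSize-0ᵛ : ∀ d s → hyperplaneSize (0ᵛ {d}) s ≡ order ^ d * 𝟙 (0# ≟ᶠ s)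
  hyperplaneSize-0ᵛ d s = begin
    ∑[ v ← vectors d ] 𝟙 (v · 0ᵛ ≟ᶠ s)   ≡⟨ ∑-cong (λ v → 𝟙-cong (_ ≟ᶠ s) (0# ≟ᶠ s) (mk⇔ (trans (sym (·-zeroʳ v))) (trans (·-zeroʳ v)))) (vectors d) ⟩
    ∑[ v ← vectors d ] 𝟙 (0# ≟ᶠ s)       ≡⟨ ∑-const _ (vectors d) ⟩
    length (vectors d) * 𝟙 (0# ≟ᶠ s)     ≡⟨ cong (_* 𝟙 (0# ≟ᶠ s)) (length-vectors d) ⟩
    order ^ d * 𝟙 (0# ≟ᶠ s)              ∎
    where open ≡-Reasoning

  order*hyperplaneSize : ∀ {d} (w : Vec Carrier d) → w ≢ 0ᵛ → ∀ s → order * hyperplaneSize w s ≡ order ^ d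
  order*hyperplaneSize []       w≢0 s = ⊥-elim (w≢0 refl)
  order*hyperplaneSize {suc d} (b ∷ w) b∷w≢0 s =
    trans (cong (order *_) (hyperplaneSize-∷ b w s)) (by-cases (w ≟ᵛ 0ᵛ))
    where
    open ≡-Reasoning
    by-cases : Dec (w ≡ 0ᵛ) → order * (∑[ a ← elements ] hyperplaneSize w (s -ᶠ a *ᶠ b)) ≡ order * order ^ d
    by-cases (no w≢0) = begin
      order * (∑[ a ← elements ] hyperplaneSize w (s -ᶠ a *ᶠ b))   ≡⟨ *-distribˡ-∑ _ order elements ⟩
      ∑[ a ← elements ] order * hyperplaneSize w (s -ᶠ a *ᶠ b)   ≡⟨ ∑-cong (λ a → order*hyperplaneSize w w≢0 _) elements ⟩
      ∑[ _ ← elements ] order ^ d                                ≡⟨ ∑-const (order ^ d) elements ⟩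
      order * order ^ d                                          ∎
    by-cases (yes refl) = cong (order *_) (begin
      ∑[ a ← elements ] hyperplaneSize (0ᵛ {d}) (s -ᶠ a *ᶠ b)         ≡⟨ ∑-cong (λ a → hyperplaneSize-0ᵛ d _) elements ⟩
      ∑[ a ← elements ] order ^ d * 𝟙 (0# ≟ᶠ s -ᶠ a *ᶠ b)       ≡⟨ ∑-cong (λ a → cong (order ^ d *_) (𝟙-cong _ (a ≟ᶠ s *ᶠ b⁻¹) solve-a)) elements ⟩
      ∑[ a ← elements ] order ^ d * 𝟙 (a ≟ᶠ s *ᶠ b⁻¹)           ≡⟨ *-distribˡ-∑ _ (order ^ d) elements ⟨
      order ^ d * Fᴹ.count (s *ᶠ b⁻¹) elements                  ≡⟨ cong (order ^ d *_) (elements-enumerate _) ⟩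
      order ^ d * 1                                             ≡⟨ *-identityʳ (order ^ d) ⟩
      order ^ d                                                 ∎)
      where
      b≢0 : b ≢ 0#
      b≢0 b≡0 = b∷w≢0 (cong (_∷ 0ᵛ) b≡0)
      b⁻¹ = proj₁ (F.inverse b b≢0)
      solve-a : ∀ {a} → (0# ≡ s -ᶠ a *ᶠ b) ⇔ (a ≡ s *ᶠ b⁻¹)
      solve-a = mk⇔
        (λ 0≡s-ab → Equivalence.to (*ᶠ-moveʳ bb⁻¹≡1) (sym (Equivalence.to x-y≡0⇔x≡y (sym 0≡s-ab))))
        (λ a≡sb⁻¹ → sym (Equivalence.from x-y≡0⇔x≡y (sym (Equivalence.from (*ᶠ-moveʳ bb⁻¹≡1) a≡sb⁻¹))))
        where bb⁻¹≡1 = proj₂ (F.inverse b b≢0)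

  order*hyperplaneSize≤ : ∀ {d} {t} → t ≢ 0# → (w : Vec Carrier d) → order * hyperplaneSize w t ≤ order ^ d
  order*hyperplaneSize≤ {d} {t} t≢0 w with w ≟ᵛ 0ᵛ
  ... | no w≢0    = ≤-reflexive (order*hyperplaneSize w w≢0 t)
  ... | yes refl = begin
    order * hyperplaneSize (0ᵛ {d}) t      ≡⟨ cong (order *_) (hyperplaneSize-0ᵛ d t) ⟩
    order * (order ^ d * 𝟙 (0# ≟ᶠ t))      ≡⟨ cong (λ n → order * (order ^ d * n)) (𝟙-no (0# ≟ᶠ t) (t≢0 ∘ sym)) ⟩
    order * (order ^ d * 0)                ≡⟨ cong (order *_) (*-zeroʳ (order ^ d)) ⟩
    order * 0                              ≤⟨ ≤-reflexive (*-zeroʳ order) ⟩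
    0                                      ≤⟨ z≤n ⟩
    order ^ d                              ∎
    where open ≤-Reasoning

  pairCount : Vec Carrier d → Vec Carrier d → Carrier → ℕ
  pairCount {d} y z s = ∑[ v ← vectors d ] 𝟙 (v · y ≟ᶠ s) * 𝟙 (v · z ≟ᶠ s)

  order*∑-pairCount : ∀ {d} (y z : Vec Carrier d) → y ≢ z →
                      order * (∑[ s ← elements ] pairCount y z s) ≡ order ^ d
  order*∑-pairCount {d} y z y≢z = begin
    order * (∑[ s ← elements ] pairCount y z s)   ≡⟨ cong (order *_) (∑-comm _ elements (vectors d)) ⟩
    order * (∑[ v ← vectors d ] ∑[ s ← elements ] 𝟙 (v · y ≟ᶠ s) * 𝟙 (v · z ≟ᶠ s))
                                                   ≡⟨ cong (order *_) (∑-cong on-hyperplane (vectors d)) ⟩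
    order * hyperplaneSize (y -ᵛ z) 0#            ≡⟨ order*hyperplaneSize (y -ᵛ z) (y≢z ∘ -ᵛ≡0⇒≡ y z) 0# ⟩
    order ^ d                                     ∎
    where
    open ≡-Reasoning
    on-hyperplane : ∀ v → ∑[ s ← elements ] 𝟙 (v · y ≟ᶠ s) * 𝟙 (v · z ≟ᶠ s) ≡ 𝟙 (v · (y -ᵛ z) ≟ᶠ 0#)
    on-hyperplane v = begin
      ∑[ s ← elements ] 𝟙 (v · y ≟ᶠ s) * 𝟙 (v · z ≟ᶠ s)   ≡⟨ ∑-cong (λ s → cong (_* 𝟙 (v · z ≟ᶠ s)) (𝟙-cong (v · y ≟ᶠ s) (s ≟ᶠ v · y) (mk⇔ sym sym))) elements ⟩
      ∑[ s ← elements ] 𝟙 (s ≟ᶠ v · y) * 𝟙 (v · z ≟ᶠ s)   ≡⟨ Fᴹ.∑-𝟙≟-* (λ s → 𝟙 (v · z ≟ᶠ s)) (v · y) elements ⟩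
      Fᴹ.count (v · y) elements * 𝟙 (v · z ≟ᶠ v · y)      ≡⟨ cong (_* 𝟙 (v · z ≟ᶠ v · y)) (elements-enumerate (v · y)) ⟩
      1 * 𝟙 (v · z ≟ᶠ v · y)                              ≡⟨ *-identityˡ _ ⟩
      𝟙 (v · z ≟ᶠ v · y)                                  ≡⟨ 𝟙-cong _ (v · (y -ᵛ z) ≟ᶠ 0#) (mk⇔
                                                              (λ vz≡vy → trans (·--ᵛʳ v y z) (Equivalence.from x-y≡0⇔x≡y (sym vz≡vy)))
                                                              (λ v[y-z]≡0 → sym (Equivalence.to x-y≡0⇔x≡y (trans (sym (·--ᵛʳ v y z)) v[y-z]≡0)))) ⟩
      𝟙 (v · (y -ᵛ z) ≟ᶠ 0#)                              ∎

  ∑-vectors-bijection : ∀ {d} (g : Vec Carrier d → ℕ) (f h : Vec Carrier d → Vec Carrier d) →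
                        (∀ v → f (h v) ≡ v) → (∀ v → h (f v) ≡ v) →
                        ∑[ v ← vectors d ] g (f v) ≡ ∑ (vectors d) g
  ∑-vectors-bijection {d} g f h fh hf = Vᴹ.∑-bijection g f h fh hf {vectors d} (vectors-enumerate d)

  pairCount-translate : ∀ {d} (y z : Vec Carrier d) t → 1 ≤ pairCount y z t → pairCount y z t ≡ pairCount y z 0#
  pairCount-translate {d} y z t pos = begin
    pairCount y z t                                                      ≡⟨ ∑-vectors-bijection _ (_+ᵛ v₀) (_-ᵛ v₀) (λ v → -ᵛ-+ᵛ v v₀) (λ v → +ᵛ--ᵛ v v₀) ⟨
    ∑[ v ← vectors d ] 𝟙 ((v +ᵛ v₀) · y ≟ᶠ t) * 𝟙 ((v +ᵛ v₀) · z ≟ᶠ t) ≡⟨ ∑-cong (λ v → cong₂ _*_ (shift v v₀·y≡t) (shift v v₀·z≡t)) (vectors d) ⟩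
    pairCount y z 0#                                                     ∎
    where
    open ≡-Reasoning
    v₀,pos = ∑-pos⇒∃ (λ v → 𝟙 (v · y ≟ᶠ t) * 𝟙 (v · z ≟ᶠ t)) (vectors d) pos
    v₀ = proj₁ v₀,pos
    v₀·y≡t = proj₁ (𝟙-*-pos (v₀ · y ≟ᶠ t) (v₀ · z ≟ᶠ t) (proj₂ v₀,pos))
    v₀·z≡t = proj₂ (𝟙-*-pos (v₀ · y ≟ᶠ t) (v₀ · z ≟ᶠ t) (proj₂ v₀,pos))
    shift : ∀ v {w} → v₀ · w ≡ t → 𝟙 ((v +ᵛ v₀) · w ≟ᶠ t) ≡ 𝟙 (v · w ≟ᶠ 0#)
    shift v {w} v₀·w≡t = 𝟙-cong _ (v · w ≟ᶠ 0#) (mk⇔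
      (λ e → trans (Equivalence.to +ᶠ-moveˡ (trans (≈⇒≡ (F.+-comm t (v · w))) (trans (cong (v · w +ᶠ_) (sym v₀·w≡t)) (trans (sym (·-+ᵛˡ v v₀ w)) e))))
                   (≈⇒≡ (F.-‿inverseʳ t)))
      (λ e → trans (·-+ᵛˡ v v₀ w) (trans (cong₂ _+ᶠ_ e v₀·w≡t) (≈⇒≡ (F.+-identityˡ t)))))

  pairCount-scale : ∀ {d} (y z : Vec Carrier d) {l l′} → l *ᶠ l′ ≡ 1# → ∀ s →
                    pairCount y z (l *ᶠ s) ≡ pairCount y z s
  pairCount-scale {d} y z {l} {l′} ll′≡1 s = begin
    pairCount y z (l *ᶠ s)                                                   ≡⟨ ∑-vectors-bijection {d} _ (l *ᵛ_) (l′ *ᵛ_) (*ᵛ-inverse ll′≡1) (*ᵛ-inverse l′l≡1) ⟨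
    ∑[ v ← vectors d ] 𝟙 ((l *ᵛ v) · y ≟ᶠ l *ᶠ s) * 𝟙 ((l *ᵛ v) · z ≟ᶠ l *ᶠ s) ≡⟨ ∑-cong (λ v → cong₂ _*_ (stretch v) (stretch v)) (vectors d) ⟩
    pairCount y z s                                                          ∎
    where
    open ≡-Reasoning
    l′l≡1 : l′ *ᶠ l ≡ 1#
    l′l≡1 = trans (≈⇒≡ (F.*-comm l′ l)) ll′≡1
    stretch : ∀ v {w} → 𝟙 ((l *ᵛ v) · w ≟ᶠ l *ᶠ s) ≡ 𝟙 (v · w ≟ᶠ s)
    stretch v {w} = 𝟙-cong _ (v · w ≟ᶠ s) (mk⇔
      (λ e → *ᶠ-cancelˡ ll′≡1 (trans (sym (·-*ᵛˡ l v w)) e))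
      (λ e → trans (·-*ᵛˡ l v w) (cong (l *ᶠ_) e)))

  pairCount-unit : ∀ {d} (y z : Vec Carrier d) {t} → t ≢ 0# → pairCount y z t ≡ pairCount y z 1#
  pairCount-unit y z {t} t≢0 = begin
    pairCount y z t           ≡⟨ cong (pairCount y z) (≈⇒≡ (F.*-identityʳ t)) ⟨
    pairCount y z (t *ᶠ 1#)   ≡⟨ pairCount-scale y z (proj₂ (F.inverse t t≢0)) 1# ⟩
    pairCount y z 1#          ∎
    where open ≡-Reasoning

  -- Scaling by a unit identifies all nonzero levels, and translating by a
  -- common solution maps level t into level 0.
  pairCount-minimal : ∀ {d} (y z : Vec Carrier d) {t} → t ≢ 0# → ∀ s → pairCount y z t ≤ pairCount y z s
  pairCount-minimal y z {t} t≢0 s with s ≟ᶠ 0# | 1 ≤? pairCount y z t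
  ... | yes refl | yes pos  = ≤-reflexive (pairCount-translate y z t pos)
  ... | yes refl | no ¬pos  = ≤-trans (s≤s⁻¹ (≰⇒> ¬pos)) z≤n
  ... | no s≢0   | _        = ≤-reflexive (trans (pairCount-unit y z t≢0) (sym (pairCount-unit y z s≢0)))

  order²*pairCount≤ : ∀ {d} (y z : Vec Carrier d) {t} → t ≢ 0# → y ≢ z →
                      order * order * pairCount y z t ≤ order ^ d
  order²*pairCount≤ {d} y z {t} t≢0 y≢z = begin
    order * order * pairCount y z t                  ≡⟨ *-assoc order order _ ⟩
    order * (order * pairCount y z t)                ≡⟨ cong (order *_) (∑-const _ elements) ⟨
    order * (∑[ _ ← elements ] pairCount y z t)      ≤⟨ *-monoʳ-≤ order (∑-mono-≤ (pairCount-minimal y z t≢0) elements) ⟩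
    order * (∑[ s ← elements ] pairCount y z s)      ≡⟨ order*∑-pairCount y z y≢z ⟩
    order ^ d                                        ∎
    where open ≤-Reasoning

  degree : Carrier → List (Vec Carrier d) → Vec Carrier d → ℕ
  degree t E v = ∑[ x ← E ] 𝟙 (v · x ≟ᶠ t)

  ∑-degree²≡∑-pairCount : ∀ {d} t (E : List (Vec Carrier d)) →
                          ∑[ v ← vectors d ] degree t E v * degree t E v ≡ ∑[ x ← E ] ∑[ z ← E ] pairCount x z t
  ∑-degree²≡∑-pairCount {d} t E = begin
    ∑[ v ← vectors d ] degree t E v * degree t E v                   ≡⟨ ∑-cong expand (vectors d) ⟩
    ∑[ v ← vectors d ] ∑[ x ← E ] ∑[ z ← E ] 𝟙 (v · x ≟ᶠ t) * 𝟙 (v · z ≟ᶠ t) ≡⟨ ∑-comm _ (vectors d) E ⟩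
    ∑[ x ← E ] ∑[ v ← vectors d ] ∑[ z ← E ] 𝟙 (v · x ≟ᶠ t) * 𝟙 (v · z ≟ᶠ t) ≡⟨ ∑-cong (λ x → ∑-comm _ (vectors d) E) E ⟩
    ∑[ x ← E ] ∑[ z ← E ] pairCount x z t                            ∎
    where
    open ≡-Reasoning
    expand : ∀ v → degree t E v * degree t E v ≡ ∑[ x ← E ] ∑[ z ← E ] 𝟙 (v · x ≟ᶠ t) * 𝟙 (v · z ≟ᶠ t)
    expand v = trans (*-distribʳ-∑ _ (degree t E v) E) (∑-cong (λ x → *-distribˡ-∑ _ (𝟙 (v · x ≟ᶠ t)) E) E)

  module _ {d} {E : List (Vec Carrier d)} (E-unique : Unique E) where

    length≤order^d : length E ≤ order ^ d
    length≤order^d = begin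
      length E                 ≡⟨ length≡∑1 E ⟩
      ∑[ _ ← E ] 1             ≤⟨ Vᴹ.∑-unique≤∑-complete (λ _ → 1) E-unique ∈-vectors ⟩
      ∑[ _ ← vectors d ] 1     ≡⟨ length≡∑1 (vectors d) ⟨
      length (vectors d)       ≡⟨ length-vectors d ⟩
      order ^ d                ∎
      where open ≤-Reasoning

    first-moment : ∀ t → length E * order ^ d ≤ order * ∑ (vectors d) (degree t E) + order ^ d
    first-moment t = begin
      length E * order ^ d                                            ≡⟨ cong (_* order ^ d) (length≡∑1 E) ⟩
      (∑[ _ ← E ] 1) * order ^ d                                      ≡⟨ *-distribʳ-∑ (λ _ → 1) (order ^ d) E ⟩
      ∑[ _ ← E ] 1 * order ^ d                                        ≤⟨ ∑-mono-≤ per-point E ⟩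
      ∑[ x ← E ] (order * hyperplaneSize x t + 𝟙 (x ≟ᵛ 0ᵛ) * order ^ d) ≡⟨ ∑-distrib-+ E ⟩
      (∑[ x ← E ] order * hyperplaneSize x t) + (∑[ x ← E ] 𝟙 (x ≟ᵛ 0ᵛ) * order ^ d)
          ≡⟨ cong₂ _+_ (trans (sym (*-distribˡ-∑ _ order E)) (cong (order *_) (sym (∑-comm _ (vectors d) E))))
                       (sym (*-distribʳ-∑ _ (order ^ d) E)) ⟩
      order * ∑ (vectors d) (degree t E) + Vᴹ.count 0ᵛ E * order ^ d   ≤⟨ +-monoʳ-≤ (order * ∑ (vectors d) (degree t E)) (*-monoˡ-≤ (order ^ d) (Vᴹ.count-unique E E-unique)) ⟩
      order * ∑ (vectors d) (degree t E) + 1 * order ^ d               ≡⟨ cong (order * ∑ (vectors d) (degree t E) +_) (*-identityˡ (order ^ d)) ⟩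
      order * ∑ (vectors d) (degree t E) + order ^ d                   ∎
      where
      open ≤-Reasoning
      per-point : ∀ x → 1 * order ^ d ≤ order * hyperplaneSize x t + 𝟙 (x ≟ᵛ 0ᵛ) * order ^ d
      per-point x with x ≟ᵛ 0ᵛ
      ... | yes _   = m≤n+m (1 * order ^ d) (order * hyperplaneSize x t)
      ... | no x≢0 = ≤-trans (≤-reflexive (trans (*-identityˡ _) (sym (order*hyperplaneSize x x≢0 t)))) (m≤m+n _ _)

    module _ {t} (t≢0 : t ≢ 0#) where

      order²*pairCount≤+diagonal : ∀ x z → order * order * pairCount x z t ≤ order ^ d + 𝟙 (z ≟ᵛ x) * (order * order ^ d)
      order²*pairCount≤+diagonal x z with z ≟ᵛ x
      ... | no z≢x   = ≤-trans (order²*pairCount≤ x z t≢0 (z≢x ∘ sym)) (m≤m+n _ _)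
      ... | yes refl = begin
        order * order * pairCount x x t     ≡⟨ *-assoc order order _ ⟩
        order * (order * pairCount x x t)   ≡⟨ cong (λ n → order * (order * n)) (∑-cong (λ v → 𝟙-idem (v · x ≟ᶠ t)) (vectors d)) ⟩
        order * (order * hyperplaneSize x t) ≤⟨ *-monoʳ-≤ order (order*hyperplaneSize≤ t≢0 x) ⟩
        order * order ^ d                   ≡⟨ *-identityˡ _ ⟨
        1 * (order * order ^ d)             ≤⟨ m≤n+m _ (order ^ d) ⟩
        order ^ d + 1 * (order * order ^ d) ∎
        where open ≤-Reasoning

      second-moment : order * order * (∑[ v ← vectors d ] degree t E v * degree t E v)
                      ≤ length E * (length E * order ^ d) + length E * (order * order ^ d)
      second-moment = begin
        order * order * (∑[ v ← vectors d ] degree t E v * degree t E v)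
            ≡⟨ cong (order * order *_) (∑-degree²≡∑-pairCount t E) ⟩
        order * order * (∑[ x ← E ] ∑[ z ← E ] pairCount x z t)
            ≡⟨ trans (*-distribˡ-∑ _ (order * order) E) (∑-cong (λ x → *-distribˡ-∑ _ (order * order) E) E) ⟩
        ∑[ x ← E ] ∑[ z ← E ] order * order * pairCount x z t
            ≤⟨ ∑-mono-≤ (λ x → ∑-mono-≤ (order²*pairCount≤+diagonal x) E) E ⟩
        ∑[ x ← E ] ∑[ z ← E ] (order ^ d + 𝟙 (z ≟ᵛ x) * (order * order ^ d))
            ≡⟨ ∑-cong (λ x → trans (∑-distrib-+ E) (cong₂ _+_ (∑-const _ E) (sym (*-distribʳ-∑ _ _ E)))) E ⟩
        ∑[ x ← E ] (length E * order ^ d + Vᴹ.count x E * (order * order ^ d))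
            ≤⟨ ∑-mono-≤ (λ x → +-monoʳ-≤ (length E * order ^ d) (*-monoˡ-≤ _ (Vᴹ.count-unique E E-unique))) E ⟩
        ∑[ x ← E ] (length E * order ^ d + 1 * (order * order ^ d))
            ≡⟨ ∑-const _ E ⟩
        length E * (length E * order ^ d + 1 * (order * order ^ d))
            ≡⟨ cong (λ m → length E * (length E * order ^ d + m)) (*-identityˡ _) ⟩
        length E * (length E * order ^ d + order * order ^ d)
            ≡⟨ *-distribˡ-+ (length E) _ _ ⟩
        length E * (length E * order ^ d) + length E * (order * order ^ d) ∎
        where open ≤-Reasoning

      private
        n = length E
        δ = degree t E

      ∑-centred-degree² : ∑[ v ← vectors d ] (n ∸ order * δ v) * (n ∸ order * δ v) ≤ 2 * n * (order * order ^ d)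
      ∑-centred-degree² = variance-from-moments {P = order ^ d} {n = n} 2≤order (first-moment t) second-moment (begin
        (∑[ v ← vectors d ] (n ∸ order * δ v) * (n ∸ order * δ v)) + 2 * n * (order * ∑ (vectors d) δ)
          ≡⟨ cong ((∑[ v ← vectors d ] (n ∸ order * δ v) * (n ∸ order * δ v)) +_)
                  (trans (cong (2 * n *_) (*-distribˡ-∑ δ order (vectors d))) (*-distribˡ-∑ _ (2 * n) (vectors d))) ⟩
        (∑[ v ← vectors d ] (n ∸ order * δ v) * (n ∸ order * δ v)) + (∑[ v ← vectors d ] 2 * n * (order * δ v))
          ≡⟨ ∑-distrib-+ (vectors d) ⟨
        ∑[ v ← vectors d ] ((n ∸ order * δ v) * (n ∸ order * δ v) + 2 * n * (order * δ v))
          ≤⟨ ∑-mono-≤ (λ v → [a∸b]²+2ab≤b²+a² n (order * δ v)) (vectors d) ⟩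
        ∑[ v ← vectors d ] ((order * δ v) * (order * δ v) + n * n)
          ≡⟨ ∑-distrib-+ (vectors d) ⟩
        (∑[ v ← vectors d ] (order * δ v) * (order * δ v)) + (∑[ _ ← vectors d ] n * n)
          ≡⟨ cong₂ _+_ (trans (∑-cong (λ v → square-* order (δ v)) (vectors d)) (sym (*-distribˡ-∑ _ (order * order) (vectors d))))
                       (trans (∑-const _ (vectors d)) (cong (_* (n * n)) (length-vectors d))) ⟩
        order * order * (∑[ v ← vectors d ] δ v * δ v) + order ^ d * (n * n) ∎)
        where
        open ≤-Reasoning
        square-* : ∀ a b → (a * b) * (a * b) ≡ a * a * (b * b)
        square-* = solve-∀

      ∑-centred-degree²-over-E : ∑[ y ← E ] (n ∸ order * δ y) * (n ∸ order * δ y) ≤ 2 * n * (order * order ^ d)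
      ∑-centred-degree²-over-E = ≤-trans (Vᴹ.∑-unique≤∑-complete _ E-unique ∈-vectors) ∑-centred-degree²

  module _ {A : Set} (_≟_ : DecidableEquality A) where

    private module Aᴹ = Multiplicity _≟_

    distinct∧all? : ∀ {k} {P : A → Set} → Decidable P → (xs : Vec A k) → Dec (Unique (V.toList xs) × VAll.All P xs)
    distinct∧all? P? xs = UDec.unique? _≟_ (V.toList xs) ×-dec VAll.all? P? xs

    ^↓≤#distinct-tuples : ∀ {E} → Unique E → ∀ k {P : A → Set} (P? : Decidable P) →
                          (∑[ x ← E ] 𝟙 (P? x)) ^↓ k ≤ ∑[ xs ← tuples F E k ] 𝟙 (distinct∧all? P? xs)
    ^↓≤#distinct-tuples E-unique zero    P? = ≤-reflexive (sym (cong (_+ 0) (𝟙-yes (distinct∧all? P? []) ([] , VAll.[]))))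
    ^↓≤#distinct-tuples {E} E-unique (suc k) {P} P? = begin
      m * (m ∸ 1) ^↓ k                                                 ≡⟨ *-distribʳ-∑ _ ((m ∸ 1) ^↓ k) E ⟩
      ∑[ a ← E ] 𝟙 (P? a) * (m ∸ 1) ^↓ k                              ≤⟨ ∑-mono-≤ extend E ⟩
      ∑[ a ← E ] ∑[ xs ← tuples F E k ] 𝟙 (distinct∧all? P? (a ∷ xs))  ≡⟨ ∑-cong (λ a → ∑-map _ (a ∷_) (tuples F E k)) E ⟨
      ∑[ a ← E ] ∑[ xs ← map (a ∷_) (tuples F E k) ] 𝟙 (distinct∧all? P? xs)
                                                                       ≡⟨ ∑-concatMap _ (λ a → map (a ∷_) (tuples F E k)) E ⟨
      ∑[ xs ← tuples F E (suc k) ] 𝟙 (distinct∧all? P? xs)            ∎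
      where
      open ≤-Reasoning
      m = ∑[ x ← E ] 𝟙 (P? x)
      extend : ∀ a → 𝟙 (P? a) * (m ∸ 1) ^↓ k ≤ ∑[ xs ← tuples F E k ] 𝟙 (distinct∧all? P? (a ∷ xs))
      extend a = begin
        𝟙 (P? a) * (m ∸ 1) ^↓ k                                          ≤⟨ *-monoʳ-≤ (𝟙 (P? a)) (^↓-monoˡ-≤ k m∸1≤m′) ⟩
        𝟙 (P? a) * m′ ^↓ k                                               ≤⟨ *-monoʳ-≤ (𝟙 (P? a)) (^↓≤#distinct-tuples E-unique k P′?) ⟩
        𝟙 (P? a) * (∑[ xs ← tuples F E k ] 𝟙 (distinct∧all? P′? xs))    ≡⟨ *-distribˡ-∑ _ (𝟙 (P? a)) (tuples F E k) ⟩
        ∑[ xs ← tuples F E k ] 𝟙 (P? a) * 𝟙 (distinct∧all? P′? xs)      ≤⟨ ∑-mono-≤ (λ xs → 𝟙-*-mono (P? a) _ (distinct∧all? P? (a ∷ xs)) cons) (tuples F E k) ⟩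
        ∑[ xs ← tuples F E k ] 𝟙 (distinct∧all? P? (a ∷ xs))            ∎
        where
        P′ : A → Set
        P′ x = P x × x ≢ a
        P′? : Decidable P′
        P′? x = P? x ×-dec ¬? (x ≟ a)
        m′ = ∑[ x ← E ] 𝟙 (P′? x)
        P-split : ∀ x → 𝟙 (P? x) ≤ 𝟙 (P′? x) + 𝟙 (x ≟ a)
        P-split x = split (P? x) (x ≟ a)
          where
          split : (Px? : Dec (P x)) (x≟a : Dec (x ≡ a)) → 𝟙 Px? ≤ 𝟙 (Px? ×-dec ¬? x≟a) + 𝟙 x≟a
          split (no _)  _       = z≤n
          split (yes _) (yes _) = s≤s z≤n
          split (yes _) (no _)  = s≤s z≤n
        m∸1≤m′ : m ∸ 1 ≤ m′
        m∸1≤m′ = begin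
          m ∸ 1                                      ≤⟨ ∸-monoˡ-≤ 1 (∑-mono-≤ P-split E) ⟩
          (∑[ x ← E ] (𝟙 (P′? x) + 𝟙 (x ≟ a))) ∸ 1   ≡⟨ cong (_∸ 1) (∑-distrib-+ E) ⟩
          (m′ + Aᴹ.count a E) ∸ 1                    ≤⟨ ∸-monoˡ-≤ 1 (+-monoʳ-≤ m′ (Aᴹ.count-unique E E-unique)) ⟩
          (m′ + 1) ∸ 1                               ≡⟨ m+n∸n≡m m′ 1 ⟩
          m′                                         ∎
        cons : ∀ {xs} → P a → Unique (V.toList xs) × VAll.All P′ xs → Unique (V.toList (a ∷ xs)) × VAll.All P (a ∷ xs)
        cons Pa (distinct , all-P′) =
          (All.map (λ x≢a a≡x → x≢a (sym a≡x)) (VAll.toList⁺ (VAll.map proj₂ all-P′)) ∷ distinct)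
          , (Pa VAll.∷ VAll.map proj₁ all-P′)

  ∑-degree^↓≤Nstars : ∀ {d} k t (E : List (Vec Carrier d)) → Unique E → ∑[ y ← E ] degree t E y ^↓ k ≤ Nstars F k t E
  ∑-degree^↓≤Nstars k t E E-unique = begin
    ∑[ y ← E ] degree t E y ^↓ k                                          ≤⟨ ∑-mono-≤ stars-at E ⟩
    ∑[ y ← E ] ∑[ xs ← tuples F E k ] 𝟙 (isStar? F t (y , xs))            ≡⟨ ∑-cartesianProduct _ E (tuples F E k) ⟨
    ∑[ p ← cartesianProduct E (tuples F E k) ] 𝟙 (isStar? F t p)          ≡⟨ length-filter (isStar? F t) (cartesianProduct E (tuples F E k)) ⟨
    Nstars F k t E                                                        ∎
    where
    open ≤-Reasoning
    stars-at : ∀ y → degree t E y ^↓ k ≤ ∑[ xs ← tuples F E k ] 𝟙 (isStar? F t (y , xs))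
    stars-at y = ≤-trans (^↓≤#distinct-tuples _≟ᵛ_ E-unique k (λ x → y · x ≟ᶠ t))
      (≤-reflexive (∑-cong (λ xs → 𝟙-cong (distinct∧all? _≟ᵛ_ _ xs) (isStar? F t (y , xs)) (mk⇔ id id)) (tuples F E k)))

lemma2p4 : (k : ℕ) → 1 ≤ k →
    ∃[ C ] ((F : FiniteField) (d : ℕ) → 1 ≤ d →
    (t : FiniteField.Carrier F) → ¬ (t ≡ FiniteField.0# F) →
    (E : List (Vec (FiniteField.Carrier F) d)) → Unique E →
    C * C * FiniteField.order F ^ (d + 1) ≤ length E ^ 2 →
    length E ^ (k + 1) ≤ 2 * FiniteField.order F ^ k * Nstars F k t E)
lemma2p4 k 1≤k = 20 * k , stars
  where
  stars : (F : FiniteField) (d : ℕ) → 1 ≤ d → _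
  stars F d _ t t≢0 E E-unique large =
    ≤-trans (∑^↓-lower-bound {E = E} (degree F t E) 1≤k 1≤q 1≤q^d (length≤order^d F E-unique)
                             (∑-centred-degree²-over-E F E-unique t≢0) large′)
            (*-monoʳ-≤ (2 * q ^ k) (∑-degree^↓≤Nstars F k t E E-unique))
    where
    q = FiniteField.order F
    1≤q : 1 ≤ q
    1≤q = ≤-trans (s≤s z≤n) (2≤order F)
    1≤q^d : 1 ≤ q ^ d
    1≤q^d = ≤-trans (≤-reflexive (sym (^-zeroˡ d))) (^-monoˡ-≤ d 1≤q)
    large′ : 20 * k * (20 * k) * (q * q ^ d) ≤ length E * length E
    large′ = subst₂ (λ x y → 20 * k * (20 * k) * x ≤ y)
                    (cong (q ^_) (+-comm d 1)) (cong (length E *_) (*-identityʳ (length E))) large
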